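{- Let $w=w_1\cdots w_n$ be a word in $\{1,\dots,q\}$, viewed as a deck of cards dealt in the order $w_1,\dots,w_n$, and consider patience sorting with ties allowed. (I) At the end of the game played with the greedy strategy, the top cards of the piles, read from left to right, coincide with the entries of the first row (read left to right) of the Hecke insertion tableau $P(w)$. (II) The greedy strategy produces exactly $\mathtt{LIS}(w)$ piles, and no legal play of the game produces fewer piles.
   Context: Patience sorting with ties allowed: cards are dealt one at a time; each card is either placed on top of an existing pile whose current top card has value greater than or equal to it, or starts a new pile to the right of all existing piles. The greedy strategy places each card on the leftmost pile whose top card is $\ge$ the card, and starts a new pile if there is none. $\mathtt{LIS}(w)$ is the length of the longest strictly increasing subsequence of $w$. An increasing tableau is a filling of a Young diagram (English notation) strictly increasing along rows and columns. Hecke insertion of $x$ into an increasing tableau $T$: insert $x$ into the first row; inserting a value $x$ into a row $R$ (an empty row below the last row is allowed): if $x$ is $\ge$ every entry of $R$, append a box containing $x$ at the end of $R$ if this yields an increasing tableau, otherwise leave the tableau unchanged, and stop. Otherwise let $y$ be the smallest entry of $R$ strictly greater than $x$; replace $y$ by $x$ if this yields an increasing tableau; in either case insert $y$ into the next row. $P(w)=((\emptyset\leftarrow w_1)\leftarrow w_2)\cdots\leftarrow w_n$. -}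

module Defs where

open import Data.Nat using (ℕ; zero; suc; _≤_; _<_; _≤ᵇ_; _<ᵇ_; _≡ᵇ_; _⊔_)
open import Data.Bool using (Bool; T?; true; false; if_then_else_; _∧_)
open import Data.List using (List; []; _∷_; _++_; [_]; length; foldl; map; filter; zipWith)
open import Data.List.Relation.Binary.Sublist.Propositional using (_⊆_)
open import Data.List.Relation.Unary.Linked using (Linked)
open import Data.Product using (Σ; _×_)
open import Relation.Binary.PropositionalEquality using (_≡_)

-- Patience sorting with ties allowed.
-- A game state is a list of piles, left to right; each pile is a list
-- of cards whose head is the top card.

data Step (c : ℕ) : List (List ℕ) → List (List ℕ) → Set where
  new   : ∀ {ps} → Step c ps (ps ++ [ c ∷ [] ])
  here  : ∀ {t p ps} → c ≤ t → Step c ((t ∷ p) ∷ ps) ((c ∷ t ∷ p) ∷ ps)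
  there : ∀ {p ps ps'} → Step c ps ps' → Step c (p ∷ ps) (p ∷ ps')

data Plays : List (List ℕ) → List ℕ → List (List ℕ) → Set where
  done : ∀ {s} → Plays s [] s
  step : ∀ {c w s s' s''} → Step c s s' → Plays s' w s'' → Plays s (c ∷ w) s''

greedyMove : ℕ → List (List ℕ) → List (List ℕ)
greedyMove c [] = (c ∷ []) ∷ []
greedyMove c ([] ∷ ps) = [] ∷ greedyMove c ps
greedyMove c ((t ∷ p) ∷ ps) =
  if c ≤ᵇ t then (c ∷ t ∷ p) ∷ ps else (t ∷ p) ∷ greedyMove c ps

greedy : List ℕ → List (List ℕ)
greedy w = foldl (λ s c → greedyMove c s) [] w

tops : List (List ℕ) → List ℕ
tops [] = []
tops ([] ∷ ps) = tops ps
tops ((t ∷ _) ∷ ps) = t ∷ tops ps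

LISLength : List ℕ → ℕ → Set
LISLength w k =
  Σ (List ℕ) (λ u → u ⊆ w × Linked _<_ u × length u ≡ k)
  × (∀ u → u ⊆ w → Linked _<_ u → length u ≤ k)

-- Increasing tableaux (English notation), rows listed top to bottom.

strictRow : List ℕ → Bool
strictRow [] = true
strictRow (a ∷ []) = true
strictRow (a ∷ b ∷ r) = (a <ᵇ b) ∧ strictRow (b ∷ r)

below : List ℕ → List ℕ → Bool
below [] [] = true
below [] (_ ∷ _) = false
below (_ ∷ _) [] = true
below (a ∷ r₁) (b ∷ r₂) = (a <ᵇ b) ∧ below r₁ r₂

nonEmpty : List ℕ → Bool
nonEmpty [] = false
nonEmpty (_ ∷ _) = true

isIncTableau : List (List ℕ) → Bool
isIncTableau [] = true
isIncTableau (r ∷ []) = nonEmpty r ∧ strictRow r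
isIncTableau (r₁ ∷ r₂ ∷ rs) =
  nonEmpty r₁ ∧ strictRow r₁ ∧ below r₁ r₂ ∧ isIncTableau (r₂ ∷ rs)

allLe : List ℕ → ℕ → Bool
allLe [] x = true
allLe (z ∷ r) x = (z ≤ᵇ x) ∧ allLe r x

minimumFrom : ℕ → List ℕ → ℕ
minimumFrom m [] = m
minimumFrom m (a ∷ r) = minimumFrom (if a <ᵇ m then a else m) r

-- smallest entry of a list (0 for the empty list; only used on nonempty lists)
minimum : List ℕ → ℕ
minimum [] = 0
minimum (a ∷ r) = minimumFrom a r

-- go above rows x : insert x into the first of `rows`, where `above` are
-- the (already processed) rows above it; the whole tableau is above ++ rows.
heckeGo : List (List ℕ) → List (List ℕ) → ℕ → List (List ℕ)
heckeGo above [] x =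
  let T' = above ++ [ x ∷ [] ] in
  if isIncTableau T' then T' else above
heckeGo above (R ∷ rest) x =
  if allLe R x
  then (let T' = above ++ (R ++ [ x ]) ∷ rest in
        if isIncTableau T' then T' else above ++ R ∷ rest)
  else (let y  = minimum (filter (λ z → T? (x <ᵇ z)) R)
            R' = map (λ z → if z ≡ᵇ y then x else z) R
            R'' = if isIncTableau (above ++ R' ∷ rest) then R' else R
        in heckeGo (above ++ [ R'' ]) rest y)

heckeInsert : List (List ℕ) → ℕ → List (List ℕ)
heckeInsert T x = heckeGo [] T x

P : List ℕ → List (List ℕ)
P w = foldl heckeInsert [] w

firstRow : List (List ℕ) → List ℕ
firstRow [] = []
firstRow (r ∷ _) = r

module Submission where

-- On top cards a greedy move is row insertion: the leftmost
-- entry ≥ c is replaced by c, or c is appended.  Hecke insertion keeps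
-- tableaux increasing and changes the first row of an increasing tableau
-- in the same way (`heckeFirstRow`, a case analysis on where the card
-- falls in the row); folding over w gives tops (greedy w) ≡ firstRow (P w).
--
-- Lower bound: the number of piles with top ≤ a never drops
-- during a legal play, and dealing c > a pushes the count at threshold c
-- above the count at a, so following an increasing subsequence every
-- play ends with at least LIS(w) piles.  Upper bound: in the greedy game
-- the top of the i-th pile ends an increasing subsequence of length i + 1,
-- so the last pile exhibits one with a card per pile.

open import Defs
open import Data.Nat using (ℕ; suc; _≤_; _<_; _+_; _≤ᵇ_; _<ᵇ_; _≡ᵇ_; z≤n; s≤s)
open import Data.Nat.Properties
open import Data.Bool using (Bool; true; false; T; if_then_else_; _∧_; T?)
open import Data.Bool.Properties using (∧-zeroʳ)
open import Data.List using (List; []; _∷_; _++_; [_]; length; foldl; map; filter)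
open import Data.List.Properties using (++-assoc; ++-identityʳ; length-++)
open import Data.List.Relation.Unary.All as All using (All; []; _∷_)
import Data.List.Relation.Unary.All.Properties as AllP using (++⁺)
open import Data.List.Relation.Unary.Linked using (Linked; []; [-]; _∷_)
open import Data.List.Relation.Binary.Sublist.Propositional using (_⊆_; []; _∷_; _∷ʳ_; ⊆-refl)
open import Data.List.Relation.Binary.Sublist.Propositional.Properties
  using (All-resp-⊆; []⊆-universal; ++⁺; ++⁺ʳ)
open import Data.Product using (_×_; _,_; Σ; proj₁; proj₂)
open import Data.Unit using (⊤; tt)
open import Data.Empty using (⊥; ⊥-elim)
open import Relation.Nullary using (¬_; yes; no; contradiction)
open import Relation.Binary.Definitions using (tri<; tri≈; tri>)
open import Relation.Binary.PropositionalEquality hiding ([_])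

T⇒≡true : ∀ {b} → T b → b ≡ true
T⇒≡true {true} _ = refl

≡true⇒T : ∀ {b} → b ≡ true → T b
≡true⇒T refl = _

<ᵇ-true : ∀ {m n} → m < n → (m <ᵇ n) ≡ true
<ᵇ-true p = T⇒≡true (<⇒<ᵇ p)

<ᵇ-false : ∀ {m n} → ¬ (m < n) → (m <ᵇ n) ≡ false
<ᵇ-false {m} {n} ¬p with m <ᵇ n in eq
... | false = refl
... | true = ⊥-elim (¬p (<ᵇ⇒< m n (≡true⇒T eq)))

<ᵇ-sound : ∀ {m n} → (m <ᵇ n) ≡ true → m < n
<ᵇ-sound {m} {n} e = <ᵇ⇒< m n (≡true⇒T e)

≤ᵇ-true : ∀ {m n} → m ≤ n → (m ≤ᵇ n) ≡ true
≤ᵇ-true p = T⇒≡true (≤⇒≤ᵇ p)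

≤ᵇ-false : ∀ {m n} → ¬ (m ≤ n) → (m ≤ᵇ n) ≡ false
≤ᵇ-false {m} {n} ¬p with m ≤ᵇ n in eq
... | false = refl
... | true = ⊥-elim (¬p (≤ᵇ⇒≤ m n (≡true⇒T eq)))

≡ᵇ-false : ∀ {m n} → m ≢ n → (m ≡ᵇ n) ≡ false
≡ᵇ-false {m} {n} ¬p with m ≡ᵇ n in eq
... | false = refl
... | true = ⊥-elim (¬p (≡ᵇ⇒≡ m n (≡true⇒T eq)))

≡ᵇ-refl : ∀ y → (y ≡ᵇ y) ≡ true
≡ᵇ-refl y = T⇒≡true (≡⇒≡ᵇ y y refl)

∧-elim : ∀ a {b} → a ∧ b ≡ true → (a ≡ true) × (b ≡ true)
∧-elim true e = refl , e

∧-intro : ∀ {a b} → a ≡ true → b ≡ true → a ∧ b ≡ true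
∧-intro refl refl = refl

rowInsert : ℕ → List ℕ → List ℕ
rowInsert x [] = x ∷ []
rowInsert x (t ∷ L) = if x ≤ᵇ t then x ∷ L else t ∷ rowInsert x L

rowInsertAll : List ℕ → List ℕ → List ℕ
rowInsertAll r w = foldl (λ r c → rowInsert c r) r w

greedyFrom : List (List ℕ) → List ℕ → List (List ℕ)
greedyFrom s w = foldl (λ s c → greedyMove c s) s w

tops-greedyMove : ∀ c s → tops (greedyMove c s) ≡ rowInsert c (tops s)
tops-greedyMove c [] = refl
tops-greedyMove c ([] ∷ ps) = tops-greedyMove c ps
tops-greedyMove c ((t ∷ p) ∷ ps) with c ≤ᵇ t
... | true = refl
... | false = cong (t ∷_) (tops-greedyMove c ps)

tops-greedyFrom : ∀ s w → tops (greedyFrom s w) ≡ rowInsertAll (tops s) w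
tops-greedyFrom s [] = refl
tops-greedyFrom s (c ∷ w) =
  trans (tops-greedyFrom (greedyMove c s) w) (cong (λ r → rowInsertAll r w) (tops-greedyMove c s))

rowInsert-prefix : ∀ {x} pre L → All (_< x) pre → rowInsert x (pre ++ L) ≡ pre ++ rowInsert x L
rowInsert-prefix [] L [] = refl
rowInsert-prefix {x} (a ∷ pre) L (a<x ∷ h) rewrite ≤ᵇ-false {x} {a} (<⇒≱ a<x) =
  cong (a ∷_) (rowInsert-prefix pre L h)

rowInsert-head : ∀ {x y} L → x ≤ y → rowInsert x (y ∷ L) ≡ x ∷ L
rowInsert-head {x} {y} L x≤y rewrite ≤ᵇ-true x≤y = refl

Inc : List (List ℕ) → Set
Inc T = isIncTableau T ≡ true

if-Inc : ∀ (b : Bool) {A B} → (b ≡ true → Inc A) → Inc B → Inc (if b then A else B)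
if-Inc true f g = f refl
if-Inc false f g = g

-- Every row update of Hecke insertion is guarded by an Inc test, so the
-- invariant is kept row by row.
heckeGo-Inc : ∀ above rows x → Inc (above ++ rows) → Inc (heckeGo above rows x)
heckeGo-Inc above [] x h =
  if-Inc (isIncTableau (above ++ [ x ∷ [] ])) (λ e → e) (subst Inc (++-identityʳ above) h)
heckeGo-Inc above (R ∷ rest) x h with allLe R x
... | true = if-Inc (isIncTableau (above ++ (R ++ [ x ]) ∷ rest)) (λ e → e) h
... | false = heckeGo-Inc (above ++ [ R'' ]) rest y (subst Inc (sym (++-assoc above [ R'' ] rest)) h')
  where
    y = minimum (filter (λ z → T? (x <ᵇ z)) R)
    R' = map (λ z → if z ≡ᵇ y then x else z) R
    R'' = if isIncTableau (above ++ R' ∷ rest) then R' else R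
    h' : Inc (above ++ R'' ∷ rest)
    h' with isIncTableau (above ++ R' ∷ rest) in eq
    ... | true = eq
    ... | false = h

heckeInsert-Inc : ∀ T x → Inc T → Inc (heckeInsert T x)
heckeInsert-Inc T x = heckeGo-Inc [] T x

heckeGo-firstRow : ∀ r above rows y → firstRow (heckeGo (r ∷ above) rows y) ≡ r
heckeGo-firstRow r above [] y with isIncTableau ((r ∷ above) ++ [ y ∷ [] ])
... | true = refl
... | false = refl
heckeGo-firstRow r above (R ∷ rest) y with allLe R y
... | true with isIncTableau ((r ∷ above) ++ (R ++ [ y ]) ∷ rest)
...   | true = refl
...   | false = refl
heckeGo-firstRow r above (R ∷ rest) y | false = heckeGo-firstRow r (above ++ [ _ ]) rest _

strictRow-tail : ∀ t L → strictRow (t ∷ L) ≡ true → strictRow L ≡ true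
strictRow-tail t [] _ = refl
strictRow-tail t (b ∷ L) s = proj₂ (∧-elim (t <ᵇ b) s)

strictRow-above : ∀ y L → strictRow (y ∷ L) ≡ true → All (y <_) L
strictRow-above y [] _ = []
strictRow-above y (b ∷ L) s = y<b ∷ All.map (<-trans y<b) (strictRow-above b L (proj₂ (∧-elim (y <ᵇ b) s)))
  where y<b = <ᵇ-sound (proj₁ (∧-elim (y <ᵇ b) s))

firstRow-strict : ∀ R rest → Inc (R ∷ rest) → strictRow R ≡ true
firstRow-strict R [] h = proj₂ (∧-elim (nonEmpty R) h)
firstRow-strict R (_ ∷ _) h = proj₁ (∧-elim (strictRow R) (proj₂ (∧-elim (nonEmpty R) h)))

data RowView (x : ℕ) : List ℕ → Set where
  allBelow       : ∀ {R} → All (_< x) R → RowView x R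
  endsWith       : ∀ pre → All (_< x) pre → RowView x (pre ++ x ∷ [])
  bumps          : ∀ pre y post → All (_< x) pre → x < y → All (y <_) post →
                   RowView x (pre ++ y ∷ post)
  bumpsAfterCopy : ∀ pre y post → All (_< x) pre → x < y → All (y <_) post →
                   RowView x ((pre ++ x ∷ []) ++ y ∷ post)

consView : ∀ {x t L} → t < x → RowView x L → RowView x (t ∷ L)
consView t<x (allBelow a) = allBelow (t<x ∷ a)
consView {t = t} t<x (endsWith pre a) = endsWith (t ∷ pre) (t<x ∷ a)
consView {t = t} t<x (bumps pre y post a x<y b) = bumps (t ∷ pre) y post (t<x ∷ a) x<y b
consView {t = t} t<x (bumpsAfterCopy pre y post a x<y b) = bumpsAfterCopy (t ∷ pre) y post (t<x ∷ a) x<y b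

rowView : ∀ x R → strictRow R ≡ true → RowView x R
rowView x [] _ = allBelow []
rowView x (t ∷ L) s with <-cmp t x
... | tri< t<x _ _ = consView t<x (rowView x L (strictRow-tail t L s))
... | tri> _ _ x<t = bumps [] t L [] x<t (strictRow-above t L s)
rowView x (x ∷ []) s | tri≈ _ refl _ = endsWith [] []
rowView x (x ∷ y ∷ post) s | tri≈ _ refl _ =
  bumpsAfterCopy [] y post [] (<ᵇ-sound (proj₁ (∧-elim (x <ᵇ y) s)))
    (strictRow-above y post (proj₂ (∧-elim (x <ᵇ y) s)))

allLe-prefix : ∀ {x} pre L → All (_≤ x) pre → allLe (pre ++ L) x ≡ allLe L x
allLe-prefix [] L [] = refl
allLe-prefix (a ∷ pre) L (a≤x ∷ h) rewrite ≤ᵇ-true a≤x = allLe-prefix pre L h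

allLe-all : ∀ {x} R → All (_≤ x) R → allLe R x ≡ true
allLe-all R h = trans (cong (λ L → allLe L _) (sym (++-identityʳ R))) (allLe-prefix R [] h)

filter-above-prefix : ∀ {x} pre L → All (_≤ x) pre →
  filter (λ z → T? (x <ᵇ z)) (pre ++ L) ≡ filter (λ z → T? (x <ᵇ z)) L
filter-above-prefix [] L [] = refl
filter-above-prefix {x} (a ∷ pre) L (a≤x ∷ h) with x <ᵇ a in eq
... | true = ⊥-elim (<-irrefl refl (<-≤-trans (<ᵇ-sound eq) a≤x))
... | false = filter-above-prefix pre L h

filter-above-all : ∀ {x} L → All (x <_) L → filter (λ z → T? (x <ᵇ z)) L ≡ L
filter-above-all [] [] = refl
filter-above-all {x} (a ∷ L) (x<a ∷ h) with x <ᵇ a in eq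
... | true = cong (a ∷_) (filter-above-all L h)
... | false = ⊥-elim (subst T eq (<⇒<ᵇ x<a))

minimumFrom-least : ∀ y L → All (y <_) L → minimumFrom y L ≡ y
minimumFrom-least y [] [] = refl
minimumFrom-least y (a ∷ L) (y<a ∷ h) rewrite <ᵇ-false {a} {y} (<⇒≯ y<a) = minimumFrom-least y L h

bumped-entry : ∀ {x y} pre post → All (_≤ x) pre → x < y → All (y <_) post →
  minimum (filter (λ z → T? (x <ᵇ z)) (pre ++ y ∷ post)) ≡ y
bumped-entry {x} {y} pre post a x<y b
  rewrite filter-above-prefix pre (y ∷ post) a
        | filter-above-all (y ∷ post) (x<y ∷ All.map (<-trans x<y) b)
  = minimumFrom-least y post b

replace-prefix : ∀ {x y} pre L → All (_< y) pre →
  map (λ z → if z ≡ᵇ y then x else z) (pre ++ L) ≡ pre ++ map (λ z → if z ≡ᵇ y then x else z) L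
replace-prefix [] L [] = refl
replace-prefix {y = y} (a ∷ pre) L (a<y ∷ h) rewrite ≡ᵇ-false {a} {y} (<⇒≢ a<y) =
  cong (a ∷_) (replace-prefix pre L h)

replace-none : ∀ {x y} L → All (y <_) L → map (λ z → if z ≡ᵇ y then x else z) L ≡ L
replace-none [] [] = refl
replace-none {y = y} (a ∷ L) (y<a ∷ h) rewrite ≡ᵇ-false {a} {y} (≢-sym (<⇒≢ y<a)) =
  cong (a ∷_) (replace-none L h)

replace-entry : ∀ {x y} pre post → All (_< y) pre → All (y <_) post →
  map (λ z → if z ≡ᵇ y then x else z) (pre ++ y ∷ post) ≡ pre ++ x ∷ post
replace-entry {x} {y} pre post a b
  rewrite replace-prefix {x} {y} pre (y ∷ post) a | ≡ᵇ-refl y | replace-none {x} {y} post b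
  = refl

Inc-replaceFirstRow : ∀ r r' rest → Inc (r ∷ rest) → nonEmpty r' ≡ true → strictRow r' ≡ true →
  (∀ r₂ → below r r₂ ≡ true → below r' r₂ ≡ true) → Inc (r' ∷ rest)
Inc-replaceFirstRow r r' [] h ne st bl = ∧-intro ne st
Inc-replaceFirstRow r r' (r₂ ∷ rs) h ne st bl =
  ∧-intro ne (∧-intro st (∧-intro (bl r₂ (proj₁ (∧-elim (below r r₂) h₂))) (proj₂ (∧-elim (below r r₂) h₂))))
  where
    h₂ = proj₂ (∧-elim (strictRow r) (proj₂ (∧-elim (nonEmpty r) h)))

Inc-nonStrict : ∀ r rest → strictRow r ≡ false → isIncTableau (r ∷ rest) ≡ false
Inc-nonStrict r [] s rewrite s = ∧-zeroʳ (nonEmpty r)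
Inc-nonStrict r (_ ∷ _) s rewrite s = ∧-zeroʳ (nonEmpty r)

nonEmpty-middle : ∀ pre (x : ℕ) post → nonEmpty (pre ++ x ∷ post) ≡ true
nonEmpty-middle [] x post = refl
nonEmpty-middle (a ∷ pre) x post = refl

below-snoc : ∀ r r₂ x → below r r₂ ≡ true → below (r ++ x ∷ []) r₂ ≡ true
below-snoc [] [] x _ = refl
below-snoc (a ∷ r) [] x _ = refl
below-snoc (a ∷ r) (b ∷ r₂) x h =
  ∧-intro (proj₁ (∧-elim (a <ᵇ b) h)) (below-snoc r r₂ x (proj₂ (∧-elim (a <ᵇ b) h)))

below-decrease : ∀ pre y post x r₂ → x ≤ y → below (pre ++ y ∷ post) r₂ ≡ true →
  below (pre ++ x ∷ post) r₂ ≡ true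
below-decrease [] y post x [] x≤y h = refl
below-decrease [] y post x (b ∷ r₂) x≤y h =
  ∧-intro (<ᵇ-true {n = b} (≤-<-trans x≤y (<ᵇ-sound {n = b} (proj₁ (∧-elim (y <ᵇ b) h))))) (proj₂ (∧-elim (y <ᵇ b) h))
below-decrease (a ∷ pre) y post x [] x≤y h = refl
below-decrease (a ∷ pre) y post x (b ∷ r₂) x≤y h =
  ∧-intro (proj₁ (∧-elim (a <ᵇ b) h)) (below-decrease pre y post x r₂ x≤y (proj₂ (∧-elim (a <ᵇ b) h)))

strictRow-snoc : ∀ r x → strictRow r ≡ true → All (_< x) r → strictRow (r ++ x ∷ []) ≡ true
strictRow-snoc [] x s [] = refl
strictRow-snoc (a ∷ []) x s (a<x ∷ []) = ∧-intro (<ᵇ-true a<x) refl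
strictRow-snoc (a ∷ b ∷ r) x s (_ ∷ h) =
  ∧-intro (proj₁ (∧-elim (a <ᵇ b) s)) (strictRow-snoc (b ∷ r) x (proj₂ (∧-elim (a <ᵇ b) s)) h)

strictRow-decrease : ∀ pre y post x → strictRow (pre ++ y ∷ post) ≡ true → All (_< x) pre → x ≤ y →
  strictRow (pre ++ x ∷ post) ≡ true
strictRow-decrease [] y [] x s [] x≤y = refl
strictRow-decrease [] y (b ∷ post) x s [] x≤y =
  ∧-intro (<ᵇ-true {n = b} (≤-<-trans x≤y (<ᵇ-sound {n = b} (proj₁ (∧-elim (y <ᵇ b) s))))) (proj₂ (∧-elim (y <ᵇ b) s))
strictRow-decrease (a ∷ []) y post x s (a<x ∷ []) x≤y =
  ∧-intro (<ᵇ-true a<x) (strictRow-decrease [] y post x (proj₂ (∧-elim (a <ᵇ y) s)) [] x≤y)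
strictRow-decrease (a ∷ b ∷ pre) y post x s (_ ∷ h) x≤y =
  ∧-intro (proj₁ (∧-elim (a <ᵇ b) s)) (strictRow-decrease (b ∷ pre) y post x (proj₂ (∧-elim (a <ᵇ b) s)) h x≤y)

strictRow-repeat : ∀ pre x post → strictRow ((pre ++ x ∷ []) ++ x ∷ post) ≡ false
strictRow-repeat [] x post rewrite <ᵇ-false {x} {x} (<-irrefl refl) = refl
strictRow-repeat (a ∷ []) x post rewrite strictRow-repeat [] x post = ∧-zeroʳ (a <ᵇ x)
strictRow-repeat (a ∷ b ∷ pre) x post rewrite strictRow-repeat (b ∷ pre) x post = ∧-zeroʳ (a <ᵇ b)

rowInsert-append : ∀ {x} R → All (_< x) R → rowInsert x R ≡ R ++ x ∷ []
rowInsert-append {x} R a = trans (cong (rowInsert x) (sym (++-identityʳ R))) (rowInsert-prefix R [] a)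

rowInsert-replace : ∀ {x y} pre post → All (_< x) pre → x ≤ y →
  rowInsert x (pre ++ y ∷ post) ≡ pre ++ x ∷ post
rowInsert-replace pre post a x≤y = trans (rowInsert-prefix pre _ a) (cong (pre ++_) (rowInsert-head post x≤y))

rowInsert-present : ∀ {x} pre L → All (_< x) pre → rowInsert x ((pre ++ x ∷ []) ++ L) ≡ (pre ++ x ∷ []) ++ L
rowInsert-present {x} pre L a = begin
  rowInsert x ((pre ++ x ∷ []) ++ L)  ≡⟨ cong (rowInsert x) (++-assoc pre (x ∷ []) L) ⟩
  rowInsert x (pre ++ x ∷ L)          ≡⟨ rowInsert-replace pre L a ≤-refl ⟩
  pre ++ x ∷ L                        ≡⟨ ++-assoc pre (x ∷ []) L ⟨
  (pre ++ x ∷ []) ++ L                ∎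
  where open ≡-Reasoning

heckeFirstRow-allBelow : ∀ R rest x → Inc (R ∷ rest) → All (_< x) R →
  firstRow (heckeInsert (R ∷ rest) x) ≡ rowInsert x R
heckeFirstRow-allBelow R rest x h a
  rewrite allLe-all R (All.map <⇒≤ a)
        | Inc-replaceFirstRow R (R ++ x ∷ []) rest h (nonEmpty-middle R x [])
            (strictRow-snoc R x (firstRow-strict R rest h) a) (λ r₂ → below-snoc R r₂ x)
  = sym (rowInsert-append R a)

heckeFirstRow-endsWith : ∀ pre rest x → All (_< x) pre →
  firstRow (heckeInsert ((pre ++ x ∷ []) ∷ rest) x) ≡ rowInsert x (pre ++ x ∷ [])
heckeFirstRow-endsWith pre rest x a
  rewrite allLe-prefix pre (x ∷ []) (All.map <⇒≤ a)
        | ≤ᵇ-true (≤-refl {x})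
        | Inc-nonStrict ((pre ++ x ∷ []) ++ x ∷ []) rest (strictRow-repeat pre x [])
  = sym (rowInsert-replace pre [] a ≤-refl)

heckeFirstRow-bumps : ∀ pre y post rest x → Inc ((pre ++ y ∷ post) ∷ rest) →
  All (_< x) pre → x < y → All (y <_) post →
  firstRow (heckeInsert ((pre ++ y ∷ post) ∷ rest) x) ≡ rowInsert x (pre ++ y ∷ post)
heckeFirstRow-bumps pre y post rest x h a x<y b
  rewrite allLe-prefix pre (y ∷ post) (All.map <⇒≤ a)
        | ≤ᵇ-false {y} {x} (<⇒≱ x<y)
        | bumped-entry pre post (All.map <⇒≤ a) x<y b
        | replace-entry {x} pre post (All.map (λ p → <-trans p x<y) a) b
        | Inc-replaceFirstRow (pre ++ y ∷ post) (pre ++ x ∷ post) rest h (nonEmpty-middle pre x post)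
            (strictRow-decrease pre y post x (firstRow-strict _ rest h) a (<⇒≤ x<y))
            (λ r₂ → below-decrease pre y post x r₂ (<⇒≤ x<y))
  = trans (heckeGo-firstRow (pre ++ x ∷ post) [] rest y) (sym (rowInsert-replace pre post a (<⇒≤ x<y)))

heckeFirstRow-bumpsAfterCopy : ∀ pre y post rest x → All (_< x) pre → x < y → All (y <_) post →
  firstRow (heckeInsert (((pre ++ x ∷ []) ++ y ∷ post) ∷ rest) x) ≡ rowInsert x ((pre ++ x ∷ []) ++ y ∷ post)
heckeFirstRow-bumpsAfterCopy pre y post rest x a x<y b
  rewrite allLe-prefix (pre ++ x ∷ []) (y ∷ post) (AllP.++⁺ (All.map <⇒≤ a) (≤-refl ∷ []))
        | ≤ᵇ-false {y} {x} (<⇒≱ x<y)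
        | bumped-entry (pre ++ x ∷ []) post (AllP.++⁺ (All.map <⇒≤ a) (≤-refl ∷ [])) x<y b
        | replace-entry {x} (pre ++ x ∷ []) post (AllP.++⁺ (All.map (λ p → <-trans p x<y) a) (x<y ∷ [])) b
        | Inc-nonStrict ((pre ++ x ∷ []) ++ x ∷ post) rest (strictRow-repeat pre x post)
  = trans (heckeGo-firstRow _ [] rest y) (sym (rowInsert-present pre (y ∷ post) a))

heckeFirstRow : ∀ T x → Inc T → firstRow (heckeInsert T x) ≡ rowInsert x (firstRow T)
heckeFirstRow [] x h = refl
heckeFirstRow (R ∷ rest) x h with rowView x R (firstRow-strict R rest h)
... | allBelow a = heckeFirstRow-allBelow R rest x h a
... | endsWith pre a = heckeFirstRow-endsWith pre rest x a
... | bumps pre y post a x<y b = heckeFirstRow-bumps pre y post rest x h a x<y b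
... | bumpsAfterCopy pre y post a x<y b = heckeFirstRow-bumpsAfterCopy pre y post rest x a x<y b

heckeFirstRow-fold : ∀ T w → Inc T → firstRow (foldl heckeInsert T w) ≡ rowInsertAll (firstRow T) w
heckeFirstRow-fold T [] h = refl
heckeFirstRow-fold T (c ∷ w) h =
  trans (heckeFirstRow-fold (heckeInsert T c) w (heckeInsert-Inc T c h))
        (cong (λ r → rowInsertAll r w) (heckeFirstRow T c h))

-- Part (I): both sides are row-insertion folds over w, started from the empty row.
tops-greedy≡firstRow-P : ∀ w → tops (greedy w) ≡ firstRow (P w)
tops-greedy≡firstRow-P w = trans (tops-greedyFrom [] w) (sym (heckeFirstRow-fold [] w refl))

lowPiles : ℕ → List (List ℕ) → ℕ
lowPiles a [] = 0
lowPiles a ([] ∷ ps) = lowPiles a ps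
lowPiles a ((t ∷ p) ∷ ps) with t ≤? a
... | yes _ = suc (lowPiles a ps)
... | no _ = lowPiles a ps

lowPiles-≤-length : ∀ a s → lowPiles a s ≤ length s
lowPiles-≤-length a [] = z≤n
lowPiles-≤-length a ([] ∷ ps) = m≤n⇒m≤1+n (lowPiles-≤-length a ps)
lowPiles-≤-length a ((t ∷ p) ∷ ps) with t ≤? a
... | yes _ = s≤s (lowPiles-≤-length a ps)
... | no _ = m≤n⇒m≤1+n (lowPiles-≤-length a ps)

lowPiles-mono : ∀ {a b} s → a ≤ b → lowPiles a s ≤ lowPiles b s
lowPiles-mono [] a≤b = z≤n
lowPiles-mono ([] ∷ ps) a≤b = lowPiles-mono ps a≤b
lowPiles-mono {a} {b} ((t ∷ p) ∷ ps) a≤b with t ≤? a | t ≤? b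
... | yes _ | yes _ = s≤s (lowPiles-mono ps a≤b)
... | yes t≤a | no t≰b = contradiction (≤-trans t≤a a≤b) t≰b
... | no _ | yes _ = m≤n⇒m≤1+n (lowPiles-mono ps a≤b)
... | no _ | no _ = lowPiles-mono ps a≤b

lowPiles-++ : ∀ a ps qs → lowPiles a (ps ++ qs) ≡ lowPiles a ps + lowPiles a qs
lowPiles-++ a [] qs = refl
lowPiles-++ a ([] ∷ ps) qs = lowPiles-++ a ps qs
lowPiles-++ a ((t ∷ p) ∷ ps) qs with t ≤? a
... | yes _ = cong suc (lowPiles-++ a ps qs)
... | no _ = lowPiles-++ a ps qs

lowPiles-single : ∀ {a c} → c ≤ a → lowPiles a ((c ∷ []) ∷ []) ≡ 1
lowPiles-single {a} {c} c≤a with c ≤? a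
... | yes _ = refl
... | no c≰a = contradiction c≤a c≰a

-- A move only lowers a top card or adds a pile, so no count decreases.
step-lowPiles-mono : ∀ {c s s'} a → Step c s s' → lowPiles a s ≤ lowPiles a s'
step-lowPiles-mono {c} {s} a new rewrite lowPiles-++ a s ((c ∷ []) ∷ []) = m≤m+n _ _
step-lowPiles-mono {c} a (here {t} c≤t) with t ≤? a | c ≤? a
... | yes _ | yes _ = ≤-refl
... | yes t≤a | no c≰a = contradiction (≤-trans c≤t t≤a) c≰a
... | no _ | yes _ = n≤1+n _
... | no _ | no _ = ≤-refl
step-lowPiles-mono a (there {[]} st) = step-lowPiles-mono a st
step-lowPiles-mono a (there {t ∷ p} st) with t ≤? a
... | yes _ = s≤s (step-lowPiles-mono a st)
... | no _ = step-lowPiles-mono a st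

-- Dealing c > a: the pile receiving c counts at threshold c, and did not
-- count at threshold a before (its top was ≥ c > a, or it is new).
step-lowPiles-grow : ∀ {c s s'} a → Step c s s' → a < c → suc (lowPiles a s) ≤ lowPiles c s'
step-lowPiles-grow {c} {s} a new a<c
  rewrite lowPiles-++ c s ((c ∷ []) ∷ []) | lowPiles-single {c} ≤-refl | +-comm (lowPiles c s) 1
  = s≤s (lowPiles-mono s (<⇒≤ a<c))
step-lowPiles-grow {c} a (here {t} {p} {ps} c≤t) a<c with t ≤? a | c ≤? c
... | yes t≤a | _ = contradiction t≤a (<⇒≱ (<-≤-trans a<c c≤t))
... | no _ | yes _ = s≤s (lowPiles-mono ps (<⇒≤ a<c))
... | no _ | no c≰c = contradiction ≤-refl c≰c
step-lowPiles-grow a (there {[]} st) a<c = step-lowPiles-grow a st a<c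
step-lowPiles-grow {c} a (there {t ∷ p} st) a<c with t ≤? a | t ≤? c
... | yes _ | yes _ = s≤s (step-lowPiles-grow a st a<c)
... | yes t≤a | no t≰c = contradiction (≤-trans t≤a (<⇒≤ a<c)) t≰c
... | no _ | yes _ = m≤n⇒m≤1+n (step-lowPiles-grow a st a<c)
... | no _ | no _ = step-lowPiles-grow a st a<c

lastOr : ℕ → List ℕ → ℕ
lastOr a [] = a
lastOr a (x ∷ v) = lastOr x v

plays-lowPiles : ∀ {s w s''} a v → Plays s w s'' → v ⊆ w → Linked _<_ (a ∷ v) →
  lowPiles a s + length v ≤ lowPiles (lastOr a v) s''
plays-lowPiles a [] done [] _ = ≤-reflexive (+-identityʳ _)
plays-lowPiles a v (step st pl) (c ∷ʳ sub) inc =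
  ≤-trans (+-monoˡ-≤ (length v) (step-lowPiles-mono a st)) (plays-lowPiles a v pl sub inc)
plays-lowPiles {s} {_} {s''} a (c ∷ v) (step {s' = s'} st pl) (refl ∷ sub) (a<c ∷ inc) = begin
  lowPiles a s + suc (length v)  ≡⟨ +-suc (lowPiles a s) (length v) ⟩
  suc (lowPiles a s) + length v  ≤⟨ +-monoˡ-≤ (length v) (step-lowPiles-grow a st a<c) ⟩
  lowPiles c s' + length v       ≤⟨ plays-lowPiles c v pl sub inc ⟩
  lowPiles (lastOr c v) s''      ∎
  where open ≤-Reasoning

plays-length-bound : ∀ {w s} → All (0 <_) w → Plays [] w s →
  ∀ u → u ⊆ w → Linked _<_ u → length u ≤ length s
plays-length-bound {s = s} pos pl u sub inc =
  ≤-trans (plays-lowPiles 0 u pl sub (from-zero (All-resp-⊆ sub pos) inc)) (lowPiles-≤-length _ s)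
  where
    from-zero : ∀ {u} → All (0 <_) u → Linked _<_ u → Linked _<_ (0 ∷ u)
    from-zero [] _ = [-]
    from-zero (0<b ∷ _) inc = 0<b ∷ inc

IncSub : List ℕ → ℕ → List ℕ → Set
IncSub w k u = u ⊆ w × Linked _<_ u × length u ≡ k

EndsAt : List ℕ → ℕ → ℕ → Set
EndsAt pre k t = Σ (List ℕ) λ v → (v ++ t ∷ []) ⊆ pre × length v ≡ k × Linked _<_ (v ++ t ∷ [])

ExtendableBy : List ℕ → ℕ → ℕ → Set
ExtendableBy pre k c = Σ (List ℕ) λ v → v ⊆ pre × length v ≡ k × Linked _<_ (v ++ c ∷ [])

-- Invariant of the greedy game after dealing pre: the pile at position i
-- (counting from 0) is nonempty and its top ends an increasing
-- subsequence of pre of length i + 1.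
GreedyInv : List ℕ → ℕ → List (List ℕ) → Set
GreedyInv pre i [] = ⊤
GreedyInv pre i ([] ∷ ps) = ⊥
GreedyInv pre i ((t ∷ p) ∷ ps) = EndsAt pre i t × GreedyInv pre (suc i) ps

Linked-snoc : ∀ xs t c → Linked _<_ (xs ++ t ∷ []) → t < c → Linked _<_ ((xs ++ t ∷ []) ++ c ∷ [])
Linked-snoc [] t c _ t<c = t<c ∷ [-]
Linked-snoc (x ∷ []) t c (x<t ∷ _) t<c = x<t ∷ Linked-snoc [] t c [-] t<c
Linked-snoc (x ∷ y ∷ xs) t c (x<y ∷ inc) t<c = x<y ∷ Linked-snoc (y ∷ xs) t c inc t<c

length-snoc : ∀ (v : List ℕ) t → length (v ++ t ∷ []) ≡ suc (length v)
length-snoc v t = trans (length-++ v) (+-comm (length v) 1)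

EndsAt-deal : ∀ {pre i t} c → EndsAt pre i t → EndsAt (pre ++ c ∷ []) i t
EndsAt-deal c (v , sub , len , inc) = v , ++⁺ʳ (c ∷ []) sub , len , inc

GreedyInv-deal : ∀ {pre} i s c → GreedyInv pre i s → GreedyInv (pre ++ c ∷ []) i s
GreedyInv-deal i [] c _ = tt
GreedyInv-deal i ((t ∷ p) ∷ ps) c (e , inv) = EndsAt-deal c e , GreedyInv-deal (suc i) ps c inv

extend-by-dealt : ∀ {pre i c} → ExtendableBy pre i c → EndsAt (pre ++ c ∷ []) i c
extend-by-dealt (v , sub , len , inc) = v , ++⁺ sub ⊆-refl , len , inc

extend-past : ∀ {pre i t c} → EndsAt pre i t → t < c → ExtendableBy pre (suc i) c
extend-past {t = t} {c} (v , sub , len , inc) t<c =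
  v ++ t ∷ [] , sub , trans (length-snoc v t) (cong suc len) , Linked-snoc v t c inc t<c

-- A greedy move keeps the invariant: the card goes past piles whose tops
-- are smaller than it, which extends their subsequences by the card.
greedyMove-inv : ∀ pre i s c → GreedyInv pre i s → ExtendableBy pre i c →
  GreedyInv (pre ++ c ∷ []) i (greedyMove c s)
greedyMove-inv pre i [] c _ ext = extend-by-dealt ext , tt
greedyMove-inv pre i ([] ∷ ps) c () ext
greedyMove-inv pre i ((t ∷ p) ∷ ps) c (e , inv) ext with c ≤ᵇ t in eq
... | true = extend-by-dealt ext , GreedyInv-deal (suc i) ps c inv
... | false = EndsAt-deal c e , greedyMove-inv pre (suc i) ps c inv (extend-past e t<c)
  where
    t<c : t < c
    t<c = ≰⇒> (λ c≤t → subst T eq (≤⇒≤ᵇ c≤t))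

greedyFrom-inv : ∀ pre s w → GreedyInv pre 0 s → GreedyInv (pre ++ w) 0 (greedyFrom s w)
greedyFrom-inv pre s [] inv = subst (λ p → GreedyInv p 0 s) (sym (++-identityʳ pre)) inv
greedyFrom-inv pre s (c ∷ w) inv =
  subst (λ p → GreedyInv p 0 (greedyFrom (greedyMove c s) w)) (++-assoc pre (c ∷ []) w)
    (greedyFrom-inv (pre ++ c ∷ []) (greedyMove c s) w
      (greedyMove-inv pre 0 s c inv ([] , []⊆-universal pre , refl , [-])))

GreedyInv-subsequence : ∀ pre i s → GreedyInv pre i s →
  Σ (List ℕ) (IncSub pre i) → Σ (List ℕ) (IncSub pre (i + length s))
GreedyInv-subsequence pre i [] _ (u , sub , inc , len) = u , sub , inc , trans len (sym (+-identityʳ i))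
GreedyInv-subsequence pre i ([] ∷ ps) () _
GreedyInv-subsequence pre i ((t ∷ p) ∷ ps) ((v , sub , len , inc) , inv) _
  with GreedyInv-subsequence pre (suc i) ps inv
         (v ++ t ∷ [] , sub , inc , trans (length-snoc v t) (cong suc len))
... | (u , sub' , inc' , len') = u , sub' , inc' , trans len' (sym (+-suc i (length ps)))

greedy-subsequence : ∀ w → Σ (List ℕ) (IncSub w (length (greedy w)))
greedy-subsequence w =
  GreedyInv-subsequence w 0 (greedy w) (greedyFrom-inv [] [] w tt) ([] , []⊆-universal w , [] , refl)

greedy-plays : ∀ s w → Plays s w (greedyFrom s w)
greedy-plays s [] = done
greedy-plays s (c ∷ w) = step (greedyMove-legal c s) (greedy-plays (greedyMove c s) w)
  where
    greedyMove-legal : ∀ c s → Step c s (greedyMove c s)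
    greedyMove-legal c [] = new
    greedyMove-legal c ([] ∷ ps) = there (greedyMove-legal c ps)
    greedyMove-legal c ((t ∷ p) ∷ ps) with c ≤ᵇ t in eq
    ... | true = here (≤ᵇ⇒≤ c t (≡true⇒T eq))
    ... | false = there (greedyMove-legal c ps)

-- Proposition 3.4: (I) is `tops-greedy≡firstRow-P`; the greedy subsequence and
-- the lower bound applied to the greedy play show that greedy uses exactly LIS(w)
-- piles, and the lower bound for any play shows that none uses fewer.
proposition3p4 : (q : ℕ) (w : List ℕ) → All (λ a → 1 ≤ a × a ≤ q) w →
    (tops (greedy w) ≡ firstRow (P w))
    × LISLength w (length (greedy w))
    × (∀ s → Plays [] w s → length (greedy w) ≤ length s)
proposition3p4 q w cards with greedy-subsequence w
... | (u , sub , inc , len) =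
  tops-greedy≡firstRow-P w ,
  ((u , sub , inc , len) , bound (greedy-plays [] w)) ,
  (λ s play → subst (_≤ length s) len (bound play u sub inc))
  where
    bound : ∀ {s} → Plays [] w s → ∀ v → v ⊆ w → Linked _<_ v → length v ≤ length s
    bound = plays-length-bound (All.map proj₁ cards)
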